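{- Let $h\geq 1$ and $d\geq 1$ be integers and let $S^h$ be the graph obtained from two disjoint copies $\mathcal{T}_s,\mathcal{T}_t$ of the tree $\mathcal{T}^h$ (with size parameter $d$), rooted at $s=rt(\mathcal{T}_s)$ and $t=rt(\mathcal{T}_t)$, by adding all edges of the complete bipartite graph $B$ between the leaf set $L(\mathcal{T}_s)$ and the leaf set $L(\mathcal{T}_t)$. Then every $2h$-FT $(s,t)$ preserver of $S^h$, and every $2h$-FT $1$-additive $(s,t)$ spanner of $S^h$, must contain every edge $e=(\ell_s,\ell_t)\in B$.
   Context: The undirected unweighted rooted tree $\mathcal{T}^h$ with size parameter $d$ is defined recursively. $\mathcal{T}^0$ is a single node, its root, which is also its unique leaf. For $h\geq 1$, take $d$ disjoint copies $\mathcal{T}^{h-1}_0,\ldots,\mathcal{T}^{h-1}_{d-1}$ of $\mathcal{T}^{h-1}$, add a new path $v_0,v_1,\ldots,v_{d-1}$, set $rt(\mathcal{T}^h)=v_0$, and for each $j$ connect $v_j$ to $rt(\mathcal{T}^{h-1}_j)$ by a path with new internal nodes of length $(d-j)(\ell(h-1)+3)$, where $\ell(h-1)$ is the height of $\mathcal{T}^{h-1}$ (maximum distance from its root to a node). The leaves $L(\mathcal{T}^h)$ are the union of the leaves of the copies $\mathcal{T}^{h-1}_j$ (so $|L(\mathcal{T}^h)|=d^h$). A subgraph $H$ is a $2h$-FT $\beta$-additive $(s,t)$ spanner if $\mathrm{dist}_{H\setminus F}(s,t)\leq\mathrm{dist}_{S^h\setminus F}(s,t)+\beta$ for every set $F$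 of at most $2h$ edges; a preserver is the case $\beta=0$. -}

module Defs where

open import Data.Nat using (ℕ; zero; suc; _+_; _*_; _∸_; _≤_; _<_; NonZero)
open import Data.Nat.Properties using (<⇒≤; ≤-refl; <-trans; n<1+n)
open import Data.Fin using (Fin; toℕ; fromℕ<)
import Data.Fin as F
open import Data.Product using (_×_; _,_; ∃; map)
open import Data.Sum using (_⊎_)
open import Data.List using (List; length)
open import Data.List.Membership.Propositional using (_∉_)
open import Relation.Binary.PropositionalEquality using (_≡_)

-- Height ℓ(h) of the tree T^h with size parameter d.
-- ℓ(0) = 0 and ℓ(h+1) = max_j ( j + (d-j)(ℓ(h)+3) + ℓ(h) ), which is attained at j = 0
-- (each unit increase of j adds 1 and removes ℓ(h)+3 ≥ 3), i.e. d(ℓ(h)+3) + ℓ(h).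
height : ℕ → ℕ → ℕ
height d zero    = 0
height d (suc h) = d * (height d h + 3) + height d h

-- Length of the path joining v_j to the root of the j-th copy of T^h inside T^(h+1).
pathLen : (d h : ℕ) → Fin d → ℕ
pathLen d h j = (d ∸ toℕ j) * (height d h + 3)

inner# : (d h : ℕ) → Fin d → ℕ
inner# d h j = pathLen d h j ∸ 1

-- Vertices of T^h (size parameter d).
--   spine j      : the node v_j of the new path v_0,...,v_{d-1}
--   inner j k p  : the (k+1)-th node (distance k+1 from v_j) on the path from v_j
--                  towards the root of the j-th copy
--   sub j x      : the node x of the j-th copy T^(h-1)_j
data TV (d : ℕ) : ℕ → Set where
  leaf  : TV d 0
  spine : ∀ {h} → Fin d → TV d (suc h)
  inner : ∀ {h} (j : Fin d) (k : ℕ) → k < inner# d h j → TV d (suc h)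
  sub   : ∀ {h} → Fin d → TV d h → TV d (suc h)

root : ∀ {d} {{_ : NonZero d}} (h : ℕ) → TV d h
root {suc n} zero    = leaf
root {suc n} (suc h) = spine F.zero

data IsLeaf {d : ℕ} : ∀ {h} → TV d h → Set where
  leaf0 : IsLeaf leaf
  subL  : ∀ {h} (j : Fin d) {x : TV d h} → IsLeaf x → IsLeaf (sub j x)

prev : ∀ {d h} (j : Fin d) (k : ℕ) → k ≤ inner# d h j → TV d (suc h)
prev j zero    _ = spine j
prev j (suc k) p = inner j k p

-- Edges of T^h (each undirected edge represented once).
--   spineE j p : v_j -- v_{j+1}
--   pathE j k p: node k -- node k+1 on the path from v_j
--   lastE j    : last internal node (or v_j) -- root of the j-th copy
--   subE j e   : edge e of the j-th copy
data TE (d : ℕ) : ℕ → Set where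
  spineE : ∀ {h} (j : ℕ) → suc j < d → TE d (suc h)
  pathE  : ∀ {h} (j : Fin d) (k : ℕ) → k < inner# d h j → TE d (suc h)
  lastE  : ∀ {h} (j : Fin d) → TE d (suc h)
  subE   : ∀ {h} → Fin d → TE d h → TE d (suc h)

tends : ∀ {d} {{_ : NonZero d}} {h} → TE d h → TV d h × TV d h
tends (spineE j p)     = spine (fromℕ< (<-trans (n<1+n j) p)) , spine (fromℕ< p)
tends (pathE j k p)    = prev j k (<⇒≤ p) , inner j k p
tends {h = suc h} (lastE j) = prev j (inner# _ h j) ≤-refl , sub j (root h)
tends (subE j e)       = map (sub j) (sub j) (tends e)

data SV (d h : ℕ) : Set where
  inS : TV d h → SV d h
  inT : TV d h → SV d h

data SE (d h : ℕ) : Set where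
  sE : TE d h → SE d h
  tE : TE d h → SE d h
  bE : (a b : TV d h) → IsLeaf a → IsLeaf b → SE d h

ends : ∀ {d} {{_ : NonZero d}} {h} → SE d h → SV d h × SV d h
ends (sE e) = map inS inS (tends e)
ends (tE e) = map inT inT (tends e)
ends (bE a b _ _) = inS a , inT b

s t : ∀ {d} {{_ : NonZero d}} {h} → SV d h
s {h = h} = inS (root h)
t {h = h} = inT (root h)

Joins : ∀ {d} {{_ : NonZero d}} {h} → SE d h → SV d h → SV d h → Set
Joins e u v = ends e ≡ (u , v) ⊎ ends e ≡ (v , u)

data Walk {d} {{_ : NonZero d}} {h} (A : SE d h → Set) : SV d h → SV d h → ℕ → Set where
  nil  : ∀ {u} → Walk A u u 0
  cons : ∀ {u w v k} (e : SE d h) → A e → Joins e u w → Walk A w v k → Walk A u v (suc k)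

-- H (a set of edges of S^h) is an f-FT β-additive (s,t) spanner of S^h:
-- for every set F of at most f edges, dist_{H∖F}(s,t) ≤ dist_{S^h∖F}(s,t) + β,
-- i.e. every s–t walk of length k in S^h ∖ F yields one of length ≤ k + β in H ∖ F
-- (this is the inequality with the convention dist = ∞ when disconnected).
FTSpanner : ∀ (d h : ℕ) {{_ : NonZero d}} (f β : ℕ) (H : SE d h → Set) → Set
FTSpanner d h f β H =
  (F : List (SE d h)) → length F ≤ f →
  (k : ℕ) → Walk (λ e → e ∉ F) s t k →
  ∃ λ k′ → k′ ≤ k + β × Walk (λ e → H e × e ∉ F) s t k′

FTPreserver : ∀ (d h : ℕ) {{_ : NonZero d}} (f : ℕ) (H : SE d h → Set) → Set
FTPreserver d h f H = FTSpanner d h f 0 H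

-- Fix leaves a ∈ T_s and b ∈ T_t. On each of the h levels of T_s fail the spine edge leaving the
-- branch that contains a (similarly for b in T_t); the s–t path through (a, b) survives, with length
-- depth a + 1 + depth b. Now take as potential the distance from s in T_s minus the faults, capped at
-- depth a + 2, and on T_t the number K = depth a + depth b + 3 minus the analogous quantity for t.
-- The path lengths (d − j)(ℓ + 3) put every other leaf of T_s at distance ≥ depth a + 2 from s, so
-- the potential changes by at most one along every surviving edge except (a, b). It rises by K from
-- s to t, so an s–t walk avoiding (a, b) and the faults is longer than depth a + depth b + 2.

module Submission where

open import Defs
open import Data.Nat using (ℕ; zero; suc; _+_; _*_; _∸_; _≤_; _<_; _⊓_; NonZero; >-nonZero; z≤n; s≤s)
open import Data.Nat.Properties
open import Data.Nat.Tactic.RingSolver using (solve-∀)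
open import Data.Fin using (Fin; toℕ; fromℕ<)
import Data.Fin as F
open import Data.Fin.Properties using (toℕ-injective; toℕ<n; toℕ-fromℕ<; fromℕ<-toℕ)
open import Data.Product using (_×_; _,_; ∃; proj₁; proj₂)
import Data.Product as P
import Data.Sum as Sum
open import Data.Sum using (_⊎_; inj₁; inj₂; [_,_]′)
open import Data.List using (List; []; _∷_; _++_; map; length)
open import Data.List.Properties using (length-++; length-map)
open import Data.List.Membership.Propositional using (_∈_; _∉_)
open import Data.List.Membership.Propositional.Properties using (∈-map⁻; ∈-map⁺; ∈-++⁻; ∈-++⁺ˡ; ∈-++⁺ʳ)
open import Data.List.Relation.Unary.Any using (here)
open import Data.Empty using (⊥-elim)
open import Function using (_∘_; id)
open import Relation.Nullary using (yes; no; ¬_)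
open import Relation.Binary using (tri<; tri≈; tri>)
open import Relation.Binary.PropositionalEquality

Near : ℕ → ℕ → Set
Near x y = x ≤ suc y × y ≤ suc x

Near-sym : ∀ {x y} → Near x y → Near y x
Near-sym (p , q) = q , p

∸-suc-≤ : ∀ m n → m ∸ n ≤ suc (m ∸ suc n)
∸-suc-≤ zero    zero    = z≤n
∸-suc-≤ zero    (suc n) = z≤n
∸-suc-≤ (suc m) zero    = ≤-refl
∸-suc-≤ (suc m) (suc n) = ∸-suc-≤ m n

Near-⊓ : ∀ {x y} c → Near x y → Near (x ⊓ c) (y ⊓ c)
Near-⊓ c (p , q) = ⊓-mono-≤ p (n≤1+n c) , ⊓-mono-≤ q (n≤1+n c)

Near-∸ : ∀ {x y} c → Near x y → Near (c ∸ x) (c ∸ y)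
Near-∸ {x} {y} c (p , q) =
  ≤-trans (∸-suc-≤ c x) (s≤s (∸-monoʳ-≤ c q)) , ≤-trans (∸-suc-≤ c y) (s≤s (∸-monoʳ-≤ c p))

Near-suc : ∀ x → Near x (suc x)
Near-suc x = m≤n⇒m≤1+n (n≤1+n x) , ≤-refl

Step : ℕ → ℕ → Set
Step x y = y ≡ suc x ⊎ y ≡ x

Step⇒Near : ∀ {x y} → Step x y → Near x y
Step⇒Near {x} (inj₁ refl) = Near-suc x
Step⇒Near {x} (inj₂ refl) = n≤1+n x , n≤1+n x

Step-+ˡ : ∀ c {x y} → Step x y → Step (c + x) (c + y)
Step-+ˡ c {x} (inj₁ refl) = inj₁ (+-suc c x)
Step-+ˡ c     (inj₂ refl) = inj₂ refl

-- Opaque so that its stuck applications unify argumentwise; it is only used through the lemmas below.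
opaque
  tri-case : ℕ → ℕ → ℕ → ℕ → ℕ → ℕ
  tri-case zero    zero    x y z = y
  tri-case zero    (suc n) x y z = x
  tri-case (suc m) zero    x y z = z
  tri-case (suc m) (suc n) x y z = tri-case m n x y z

opaque
  unfolding tri-case

  tri-case-< : ∀ {m n x y z} → m < n → tri-case m n x y z ≡ x
  tri-case-< {zero}  {suc n} _         = refl
  tri-case-< {suc m} {suc n} (s≤s m<n) = tri-case-< m<n

  tri-case-≡ : ∀ {m n x y z} → m ≡ n → tri-case m n x y z ≡ y
  tri-case-≡ {zero}  refl = refl
  tri-case-≡ {suc m} refl = tri-case-≡ {m} refl

  tri-case-> : ∀ {m n x y z} → n < m → tri-case m n x y z ≡ z
  tri-case-> {suc m} {zero}  _         = refl
  tri-case-> {suc m} {suc n} (s≤s n<m) = tri-case-> n<m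

  tri-case-step : ∀ {m n x y z x′ y′} → (m < n → Step x x′) → (m ≡ n → Step y y′) →
    Step (tri-case m n x y z) (tri-case m n x′ y′ z)
  tri-case-step {zero}  {zero}  lt eq = eq refl
  tri-case-step {zero}  {suc n} lt eq = lt (s≤s z≤n)
  tri-case-step {suc m} {zero}  lt eq = inj₂ refl
  tri-case-step {suc m} {suc n} lt eq = tri-case-step {m} {n} (lt ∘ s≤s) (eq ∘ cong suc)

tri-case-≤ : ∀ {m n x z} → m ≤ n → tri-case m n x x z ≡ x
tri-case-≤ m≤n with m≤n⇒m<n∨m≡n m≤n
... | inj₁ m<n = tri-case-< m<n
... | inj₂ m≡n = tri-case-≡ m≡n

tri-case-next : ∀ {m n} z → m ≢ n → Step (tri-case m n m m z) (tri-case (suc m) n (suc m) (suc m) z)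
tri-case-next {m} {n} z m≢n with <-cmp m n
... | tri< m<n _ _ = subst₂ Step (sym (tri-case-< m<n)) (sym (tri-case-≤ m<n)) (inj₁ refl)
... | tri≈ _ m≡n _ = ⊥-elim (m≢n m≡n)
... | tri> _ _ n<m = subst₂ Step (sym (tri-case-> n<m)) (sym (tri-case-> (m<n⇒m<1+n n<m))) (inj₂ refl)

0<n+3 : ∀ n → 0 < n + 3
0<n+3 n = ≤-trans (s≤s z≤n) (m≤n+m 3 n)

pathLen≡1+inner# : ∀ d h (i : Fin d) → pathLen d h i ≡ suc (inner# d h i)
pathLen≡1+inner# d h i = sym (m+[n∸m]≡n (*-mono-≤ (m<n⇒0<n∸m (toℕ<n i)) (0<n+3 (height d h))))

branch-depth-≤ : ∀ {j d} H {L} → j ≤ d → L ≤ H → j + (d ∸ j) * (H + 3) + L ≤ d * (H + 3) + H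
branch-depth-≤ {j} {d} H {L} j≤d L≤H = begin
  j + (d ∸ j) * (H + 3) + L            ≤⟨ +-mono-≤ (+-monoˡ-≤ _ (m≤m*n j (H + 3) {{>-nonZero (0<n+3 H)}})) L≤H ⟩
  j * (H + 3) + (d ∸ j) * (H + 3) + H  ≡⟨ cong (_+ H) (sym (*-distribʳ-+ (H + 3) j (d ∸ j))) ⟩
  (j + (d ∸ j)) * (H + 3) + H          ≡⟨ cong (λ n → n * (H + 3) + H) (m+[n∸m]≡n j≤d) ⟩
  d * (H + 3) + H                      ∎
  where open ≤-Reasoning

-- The subtraction-free form of earlier-branch-deeper, with j = suc i + t and d = j + q.
earlier-branch-deeper′ : ∀ i t q H L z → L ≤ H →
  2 + (suc i + t + q * (H + 3) + L) ≤ i + (suc t + q) * (H + 3) + z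
earlier-branch-deeper′ i t q H L z L≤H = begin
  2 + (suc i + t + q * (H + 3) + L)         ≡⟨ lhs i t q (H + 3) L ⟩
  (i + q * (H + 3)) + (t + (L + 3))         ≤⟨ +-monoʳ-≤ (i + q * (H + 3)) slack ⟩
  (i + q * (H + 3)) + (t * (H + 3) + (H + 3) + z)  ≡⟨ rhs i t q (H + 3) z ⟩
  i + (suc t + q) * (H + 3) + z             ∎
  where
  open ≤-Reasoning
  lhs : ∀ i t q c L → 2 + (suc i + t + q * c + L) ≡ (i + q * c) + (t + (L + 3))
  lhs = solve-∀
  rhs : ∀ i t q c z → (i + q * c) + (t * c + c + z) ≡ i + (suc t + q) * c + z
  rhs = solve-∀
  slack : t + (L + 3) ≤ t * (H + 3) + (H + 3) + z
  slack = ≤-trans (+-mono-≤ (m≤m*n t (H + 3) {{>-nonZero (0<n+3 H)}}) (+-monoˡ-≤ 3 L≤H)) (m≤m+n _ z)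

earlier-branch-deeper : ∀ {i j d} H {L} z → i < j → j ≤ d → L ≤ H →
  2 + (j + (d ∸ j) * (H + 3) + L) ≤ i + (d ∸ i) * (H + 3) + z
earlier-branch-deeper {i} H {L} z i<j j≤d L≤H with m≤n⇒∃[o]m+o≡n i<j | m≤n⇒∃[o]m+o≡n j≤d
... | t , refl | q , refl = subst₂ (λ a b → 2 + (suc i + t + a * (H + 3) + L) ≤ i + b * (H + 3) + z)
  (sym (m+n∸m≡n (suc i + t) q)) (sym d∸i) (earlier-branch-deeper′ i t q H L z L≤H)
  where
  d∸i : suc i + t + q ∸ i ≡ suc t + q
  d∸i = trans (cong (_∸ i) (trans (+-assoc (suc i) t q) (sym (+-suc i (t + q))))) (m+n∸m≡n i (suc t + q))

Links : ∀ {V E : Set} → (E → V × V) → E → V → V → Set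
Links ends e u v = ends e ≡ (u , v) ⊎ ends e ≡ (v , u)

Links-sym : ∀ {V E : Set} {ends : E → V × V} {e u v} → Links ends e u v → Links ends e v u
Links-sym (inj₁ eq) = inj₂ eq
Links-sym (inj₂ eq) = inj₁ eq

data Path {V E : Set} (ends : E → V × V) (A : E → Set) : V → V → ℕ → Set where
  nil  : ∀ {u} → Path ends A u u 0
  cons : ∀ {u w v k} (e : E) → A e → Links ends e u w → Path ends A w v k → Path ends A u v (suc k)

module _ {V E : Set} {ends : E → V × V} {A : E → Set} where

  snoc : ∀ {u v w k} → Path ends A u v k → (e : E) → A e → Links ends e v w → Path ends A u w (suc k)
  snoc nil               e a j = cons e a j nil
  snoc (cons e′ a′ j′ p) e a j = cons e′ a′ j′ (snoc p e a j)

  _++ᵖ_ : ∀ {u v w k m} → Path ends A u v k → Path ends A v w m → Path ends A u w (k + m)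
  nil          ++ᵖ q = q
  cons e a j p ++ᵖ q = cons e a j (p ++ᵖ q)

  reverse : ∀ {u v k} → Path ends A u v k → Path ends A v u k
  reverse nil            = nil
  reverse (cons e a j p) = snoc (reverse p) e a (Links-sym {ends = ends} j)

map-Path : ∀ {V E V′ E′ : Set} {ends : E → V × V} {ends′ : E′ → V′ × V′}
  (f : V → V′) (g : E → E′) → (∀ e → ends′ (g e) ≡ P.map f f (ends e)) →
  ∀ {A B} → (∀ {e} → A e → B (g e)) →
  ∀ {u v k} → Path ends A u v k → Path ends′ B (f u) (f v) k
map-Path f g g-ends A⇒B nil = nil
map-Path {ends = ends} {ends′} f g g-ends A⇒B (cons e a j p) =
  cons (g e) (A⇒B a) (map-Links j) (map-Path f g g-ends A⇒B p)
  where
  map-Links : ∀ {e u w} → Links ends e u w → Links ends′ (g e) (f u) (f w)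
  map-Links {e} (inj₁ eq) = inj₁ (trans (g-ends e) (cong (P.map f f) eq))
  map-Links {e} (inj₂ eq) = inj₂ (trans (g-ends e) (cong (P.map f f) eq))

Path⇒Walk : ∀ {d} {{_ : NonZero d}} {h} {A : SE d h → Set} {u v k} → Path ends A u v k → Walk A u v k
Path⇒Walk nil            = nil
Path⇒Walk (cons e a j p) = cons e a j (Path⇒Walk p)

-- Stated for d = suc n, the case in which root, and with it tends, computes.
module Tree (n : ℕ) where

  d : ℕ
  d = suc n

  depth : ∀ {h} → TV d h → ℕ
  depth leaf          = 0
  depth (spine i)     = toℕ i
  depth (inner i k _) = toℕ i + suc k
  depth {suc h} (sub i x) = toℕ i + pathLen d h i + depth x

  depth-root : ∀ h → depth (root {d} h) ≡ 0
  depth-root zero    = refl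
  depth-root (suc h) = refl

  depth-prev : ∀ {h} (i : Fin d) k (k≤ : k ≤ inner# d h i) → depth (prev {d} {h} i k k≤) ≡ toℕ i + k
  depth-prev i zero    _ = sym (+-identityʳ (toℕ i))
  depth-prev i (suc k) _ = refl

  depth-sub-root : ∀ h (i : Fin d) → depth (sub {d} {h} i (root h)) ≡ suc (toℕ i + inner# d h i)
  depth-sub-root h i = begin
    toℕ i + pathLen d h i + depth (root {d} h)  ≡⟨ cong (toℕ i + pathLen d h i +_) (depth-root h) ⟩
    toℕ i + pathLen d h i + 0                   ≡⟨ +-identityʳ _ ⟩
    toℕ i + pathLen d h i                       ≡⟨ cong (toℕ i +_) (pathLen≡1+inner# d h i) ⟩
    toℕ i + suc (inner# d h i)                  ≡⟨ +-suc _ _ ⟩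
    suc (toℕ i + inner# d h i)                  ∎
    where open ≡-Reasoning

  depth-step : ∀ {h} (e : TE d h) {x y} → tends e ≡ (x , y) → depth y ≡ suc (depth x)
  depth-step (spineE i p)  refl = trans (toℕ-fromℕ< p) (cong suc (sym (toℕ-fromℕ< _)))
  depth-step (pathE i k p) refl = trans (+-suc _ _) (cong suc (sym (depth-prev i k (<⇒≤ p))))
  depth-step {suc h} (lastE i) refl = trans (depth-sub-root h i) (cong suc (sym (depth-prev i _ ≤-refl)))
  depth-step {suc h} (subE i e) eq with tends e in eq′ | eq
  ... | _ | refl = trans (cong (toℕ i + pathLen d h i +_) (depth-step e eq′)) (+-suc _ _)

  depth-leaf-≤ : ∀ {h} {a : TV d h} → IsLeaf a → depth a ≤ height d h
  depth-leaf-≤ leaf0 = z≤n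
  depth-leaf-≤ {suc h} (subL j pa) = branch-depth-≤ (height d h) (<⇒≤ (toℕ<n j)) (depth-leaf-≤ pa)

  IsLeaf-irrelevant : ∀ {h} {x : TV d h} (p q : IsLeaf x) → p ≡ q
  IsLeaf-irrelevant leaf0      leaf0       = refl
  IsLeaf-irrelevant (subL j p) (subL .j q) = cong (subL j) (IsLeaf-irrelevant p q)

  spineCut : ∀ {h} → Fin d → List (TE d (suc h))
  spineCut j with suc (toℕ j) <? d
  ... | yes p = spineE (toℕ j) p ∷ []
  ... | no _  = []

  spineE∈spineCut : ∀ {h} (j : Fin d) (p : suc (toℕ j) < d) → spineE {h = h} (toℕ j) p ∈ spineCut j
  spineE∈spineCut j p with suc (toℕ j) <? d
  ... | yes p′ = here (cong (spineE (toℕ j)) (<-irrelevant p p′))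
  ... | no ¬p  = ⊥-elim (¬p p)

  ∈-spineCut : ∀ {h} (j : Fin d) {e : TE d (suc h)} → e ∈ spineCut j → ∃ λ p → e ≡ spineE (toℕ j) p
  ∈-spineCut j e∈ with suc (toℕ j) <? d
  ∈-spineCut j (here refl) | yes p = p , refl

  length-spineCut : ∀ {h} (j : Fin d) → length (spineCut {h} j) ≤ 1
  length-spineCut j with suc (toℕ j) <? d
  ... | yes _ = ≤-refl
  ... | no _  = z≤n

  cut : ∀ {h} {a : TV d h} → IsLeaf a → List (TE d h)
  cut leaf0       = []
  cut (subL j pa) = spineCut j ++ map (subE j) (cut pa)

  length-cut : ∀ {h} {a : TV d h} (pa : IsLeaf a) → length (cut pa) ≤ h
  length-cut leaf0 = z≤n
  length-cut {suc h} (subL j pa) = begin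
    length (spineCut j ++ map (subE j) (cut pa))          ≡⟨ length-++ (spineCut j) ⟩
    length (spineCut j) + length (map (subE j) (cut pa))  ≡⟨ cong (length (spineCut j) +_) (length-map (subE j) (cut pa)) ⟩
    length (spineCut j) + length (cut pa)                 ≤⟨ +-mono-≤ (length-spineCut j) (length-cut pa) ⟩
    1 + h                                                 ∎
    where open ≤-Reasoning

  ∈-cut : ∀ {h} {a : TV d h} (j : Fin d) (pa : IsLeaf a) {e : TE d (suc h)} → e ∈ cut (subL j pa) →
    (∃ λ p → e ≡ spineE (toℕ j) p) ⊎ (∃ λ e′ → e ≡ subE j e′ × e′ ∈ cut pa)
  ∈-cut j pa e∈ with ∈-++⁻ (spineCut j) e∈
  ... | inj₁ e∈spine = inj₁ (∈-spineCut j e∈spine)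
  ... | inj₂ e∈sub with ∈-map⁻ (subE j) e∈sub
  ... | e′ , e′∈ , refl = inj₂ (e′ , refl , e′∈)

  -- The distance from the root in the tree minus cut pa; the vertices cut off from the root
  -- (those in branches after the one containing a) are all placed at 2 + depth a.
  dist : ∀ {h} {a : TV d h} → IsLeaf a → TV d h → ℕ
  dist leaf0 _ = 0
  dist {a = a} (subL j pa) (spine i)     = tri-case (toℕ i) (toℕ j) (toℕ i) (toℕ i) (2 + depth a)
  dist {a = a} (subL j pa) (inner i k _) = tri-case (toℕ i) (toℕ j) (toℕ i + suc k) (toℕ i + suc k) (2 + depth a)
  dist {suc h} {a} (subL j pa) (sub i x) =
    tri-case (toℕ i) (toℕ j) (depth (sub i x)) (toℕ j + pathLen d h j + dist pa x) (2 + depth a)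

  dist-root : ∀ {h} {a : TV d h} (pa : IsLeaf a) → dist pa (root h) ≡ 0
  dist-root leaf0       = refl
  dist-root (subL j pa) = tri-case-≤ {n = toℕ j} z≤n

  dist-self : ∀ {h} {a : TV d h} (pa : IsLeaf a) → dist pa a ≡ depth a
  dist-self leaf0 = refl
  dist-self {suc h} (subL j pa) = trans (tri-case-≡ {n = toℕ j} refl) (cong (toℕ j + pathLen d h j +_) (dist-self pa))

  dist-prev : ∀ {h} {a : TV d h} (j : Fin d) (pa : IsLeaf a) (i : Fin d) k (k≤ : k ≤ inner# d h i) →
    dist (subL j pa) (prev i k k≤) ≡ tri-case (toℕ i) (toℕ j) (toℕ i + k) (toℕ i + k) (2 + depth (sub j a))
  dist-prev j pa i zero    _ = cong (λ x → tri-case (toℕ i) (toℕ j) x x _) (sym (+-identityʳ (toℕ i)))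
  dist-prev j pa i (suc k) _ = refl

  dist-step : ∀ {h} {a : TV d h} (pa : IsLeaf a) (e : TE d h) {x y} → tends e ≡ (x , y) →
    e ∈ cut pa ⊎ Step (dist pa x) (dist pa y)
  dist-step leaf0 () _
  dist-step {a = a} (subL j pa) (spineE i p) refl with i ≟ toℕ j
  ... | yes refl = inj₁ (∈-++⁺ˡ (spineE∈spineCut j p))
  ... | no i≢j   = inj₂ (subst₂ (λ x y → Step (tri-case x (toℕ j) x x far) (tri-case y (toℕ j) y y far))
                          (sym (toℕ-fromℕ< _)) (sym (toℕ-fromℕ< p)) (tri-case-next far i≢j))
    where far = 2 + depth a
  dist-step (subL j pa) (pathE i k p) refl =
    inj₂ (subst (λ v → Step v (dist (subL j pa) (inner i k p))) (sym (dist-prev j pa i k (<⇒≤ p)))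
            (tri-case-step (λ _ → inj₁ (+-suc _ k)) (λ _ → inj₁ (+-suc _ k))))
  dist-step {suc h} (subL j pa) (lastE i) refl =
    inj₂ (subst (λ v → Step v (dist (subL j pa) (sub i (root h)))) (sym (dist-prev j pa i _ ≤-refl))
            (tri-case-step (λ _ → inj₁ (depth-sub-root h i)) (inj₁ ∘ same-branch)))
    where
    same-branch : toℕ i ≡ toℕ j → toℕ j + pathLen d h j + dist pa (root h) ≡ suc (toℕ i + inner# d h i)
    same-branch i≡j with toℕ-injective i≡j
    ... | refl = trans (cong (toℕ i + pathLen d h i +_) (trans (dist-root pa) (sym (depth-root h))))
                       (depth-sub-root h i)
  dist-step {suc h} (subL j pa) (subE i e) eq with tends e in eq′ | eq
  ... | _ | refl with i F.≟ j
  ... | no i≢j = inj₂ (tri-case-step (λ _ → inj₁ (depth-step (subE i e) (cong (P.map (sub i) (sub i)) eq′)))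
                                       (⊥-elim ∘ i≢j ∘ toℕ-injective))
  ... | yes refl with dist-step pa e eq′
  ...   | inj₁ e∈  = inj₁ (∈-++⁺ʳ (spineCut i) (∈-map⁺ (subE i) e∈))
  ...   | inj₂ st  = inj₂ (subst₂ Step (sym (tri-case-≡ {n = toℕ i} refl)) (sym (tri-case-≡ {n = toℕ i} refl))
                                         (Step-+ˡ _ st))

  other-leaf-far : ∀ {h} {a x : TV d h} (pa : IsLeaf a) → IsLeaf x → x ≡ a ⊎ 2 + depth a ≤ dist pa x
  other-leaf-far leaf0 leaf0 = inj₁ refl
  other-leaf-far {suc h} (subL j {a} pa) (subL i {x} px) with <-cmp (toℕ i) (toℕ j)
  ... | tri< i<j _ _ = inj₂ (subst (_ ≤_) (sym (tri-case-< i<j))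
        (earlier-branch-deeper (height d h) (depth x) i<j (<⇒≤ (toℕ<n j)) (depth-leaf-≤ pa)))
  ... | tri> _ _ j<i = inj₂ (≤-reflexive (sym (tri-case-> j<i)))
  ... | tri≈ _ i≡j _ with toℕ-injective i≡j
  ... | refl with other-leaf-far pa px
  ...   | inj₁ refl = inj₁ refl
  ...   | inj₂ far  = inj₂ (begin
    2 + (c + depth a)           ≡⟨ sym (trans (+-suc c _) (cong suc (+-suc c _))) ⟩
    c + (2 + depth a)           ≤⟨ +-monoʳ-≤ c far ⟩
    c + dist pa x               ≡⟨ sym (tri-case-≡ i≡j) ⟩
    dist (subL i pa) (sub i x)  ∎)
    where
    open ≤-Reasoning
    c = toℕ i + pathLen d h i

  TreePath : ∀ {h} → (TE d h → Set) → TV d h → TV d h → ℕ → Set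
  TreePath = Path tends

  ∉-cut : ∀ {h} {a : TV d h} (j : Fin d) (pa : IsLeaf a) {e : TE d (suc h)} →
    (∀ p → e ≢ spineE (toℕ j) p) → (∀ {e′} → e ≡ subE j e′ → e′ ∉ cut pa) → e ∉ cut (subL j pa)
  ∉-cut j pa not-spine not-sub e∈ with ∈-cut j pa e∈
  ... | inj₁ (p , e≡)       = not-spine p e≡
  ... | inj₂ (e′ , e≡ , e′∈) = not-sub e≡ e′∈

  along-spine : ∀ {h} {a : TV d h} (j : Fin d) (pa : IsLeaf a) m (m<d : m < d) → m ≤ toℕ j →
    TreePath (_∉ cut (subL j pa)) (spine F.zero) (spine (fromℕ< m<d)) m
  along-spine j pa zero    _   _   = nil
  along-spine j pa (suc m) m<d m≤j =
    snoc (along-spine j pa m (<-trans (n<1+n m) m<d) (<⇒≤ m≤j)) (spineE m m<d)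
         (∉-cut j pa (λ { _ refl → <-irrefl refl m≤j }) (λ ())) (inj₁ refl)

  along-path : ∀ {h} {a : TV d h} (j : Fin d) (pa : IsLeaf a) m (m≤ : m ≤ inner# d h j) →
    TreePath (_∉ cut (subL j pa)) (spine j) (prev j m m≤) m
  along-path j pa zero    _  = nil
  along-path j pa (suc m) m< =
    snoc (along-path j pa m (<⇒≤ m<)) (pathE j m m<) (∉-cut j pa (λ _ ()) (λ ())) (inj₁ refl)

  root-to-leaf : ∀ {h} {a : TV d h} (pa : IsLeaf a) → TreePath (_∉ cut pa) (root h) a (depth a)
  root-to-leaf leaf0 = nil
  root-to-leaf {suc h} (subL j {a} pa) =
    subst (TreePath _ (spine F.zero) (sub j a)) length-≡
      (to-branch ++ᵖ (snoc (along-path j pa _ ≤-refl) (lastE j) (∉-cut j pa (λ _ ()) (λ ())) (inj₁ refl)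
                      ++ᵖ map-Path (sub j) (subE j) (λ _ → refl)
                                   (λ e∉ → ∉-cut j pa (λ _ ()) (λ { refl → e∉ })) (root-to-leaf pa)))
    where
    to-branch : TreePath (_∉ cut (subL j pa)) (spine F.zero) (spine j) (toℕ j)
    to-branch = subst (λ i → TreePath (_∉ cut (subL j pa)) (spine F.zero) (spine i) (toℕ j))
                      (fromℕ<-toℕ j (toℕ<n j)) (along-spine j pa (toℕ j) (toℕ<n j) ≤-refl)
    length-≡ : toℕ j + (suc (inner# d h j) + depth a) ≡ toℕ j + pathLen d h j + depth a
    length-≡ = trans (sym (+-assoc (toℕ j) _ _))
                     (cong (λ l → toℕ j + l + depth a) (sym (pathLen≡1+inner# d h j)))

FTSpanner-mono : ∀ {d} {{_ : NonZero d}} {h f β β′} {H : SE d h → Set} → β ≤ β′ →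
  FTSpanner d h f β H → FTSpanner d h f β′ H
FTSpanner-mono {β = β} {β′} β≤β′ span F |F|≤ k w with span F |F|≤ k w
... | k′ , k′≤ , w′ = k′ , ≤-trans k′≤ (+-monoʳ-≤ k β≤β′) , w′

NearAlong : ∀ {d} {{_ : NonZero d}} {h} → (SV d h → ℕ) → SE d h → Set
NearAlong φ e = Near (φ (proj₁ (ends e))) (φ (proj₂ (ends e)))

walk-potential-bound : ∀ {d} {{_ : NonZero d}} {h} {A : SE d h → Set} {B : Set} (φ : SV d h → ℕ) →
  (∀ {e} → A e → B ⊎ NearAlong φ e) →
  ∀ {u v k} → Walk A u v k → B ⊎ φ v ≤ k + φ u
walk-potential-bound φ near nil = inj₂ ≤-refl
walk-potential-bound φ near {u} (cons {k = k} e a j w) with near a | walk-potential-bound φ near w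
... | inj₁ b    | _         = inj₁ b
... | inj₂ _    | inj₁ b    = inj₁ b
... | inj₂ φe≈ | inj₂ φv≤ =
  inj₂ (≤-trans φv≤ (≤-trans (+-monoʳ-≤ k (across j φe≈)) (≤-reflexive (+-suc k (φ u)))))
  where
  across : ∀ {w} → Joins e u w → NearAlong φ e → φ w ≤ suc (φ u)
  across (inj₁ eq) φe≈ rewrite eq = proj₂ φe≈
  across (inj₂ eq) φe≈ rewrite eq = proj₁ φe≈

module Forcing (n : ℕ) {h : ℕ} {a b : TV (suc n) h} (pa : IsLeaf a) (pb : IsLeaf b) where
  open Tree n

  e₀ : SE d h
  e₀ = bE a b pa pb

  faults : List (SE d h)
  faults = map sE (cut pa) ++ map tE (cut pb)

  length-faults : length faults ≤ 2 * h
  length-faults = begin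
    length faults                                         ≡⟨ length-++ (map sE (cut pa)) ⟩
    length (map sE (cut pa)) + length (map tE (cut pb))   ≡⟨ cong₂ _+_ (length-map sE (cut pa)) (length-map tE (cut pb)) ⟩
    length (cut pa) + length (cut pb)                     ≤⟨ +-mono-≤ (length-cut pa) (length-cut pb) ⟩
    h + h                                                 ≡⟨ cong (h +_) (sym (+-identityʳ h)) ⟩
    2 * h                                                 ∎
    where open ≤-Reasoning

  ∈-faults : ∀ {e} → e ∈ faults →
    (∃ λ e′ → e′ ∈ cut pa × e ≡ sE e′) ⊎ (∃ λ e′ → e′ ∈ cut pb × e ≡ tE e′)
  ∈-faults = Sum.map (∈-map⁻ sE) (∈-map⁻ tE) ∘ ∈-++⁻ (map sE (cut pa))

  sE∈faults : ∀ {e} → sE e ∈ faults → e ∈ cut pa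
  sE∈faults e∈ with ∈-faults e∈
  ... | inj₁ (_ , e∈cut , refl) = e∈cut
  ... | inj₂ (_ , _ , ())

  tE∈faults : ∀ {e} → tE e ∈ faults → e ∈ cut pb
  tE∈faults e∈ with ∈-faults e∈
  ... | inj₁ (_ , _ , ())
  ... | inj₂ (_ , e∈cut , refl) = e∈cut

  bE∉faults : ∀ {x y px py} → bE x y px py ∉ faults
  bE∉faults e∈ with ∈-faults e∈
  ... | inj₁ (_ , _ , ())
  ... | inj₂ (_ , _ , ())

  detour : Walk (_∉ faults) s t (depth a + suc (depth b))
  detour = Path⇒Walk
    (map-Path inS sE (λ _ → refl) (λ e∉ → e∉ ∘ sE∈faults) (root-to-leaf pa)
     ++ᵖ cons e₀ bE∉faults (inj₁ refl)
               (map-Path inT tE (λ _ → refl) (λ e∉ → e∉ ∘ tE∈faults) (reverse (root-to-leaf pb))))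

  capped : ∀ {x : TV d h} → IsLeaf x → TV d h → ℕ
  capped {x} px y = dist px y ⊓ (2 + depth x)

  capped-root : ∀ {x : TV d h} (px : IsLeaf x) → capped px (root h) ≡ 0
  capped-root px = cong (_⊓ _) (dist-root px)

  capped-self : ∀ {x : TV d h} (px : IsLeaf x) → capped px x ≡ depth x
  capped-self {x} px = trans (cong (_⊓ _) (dist-self px)) (m≤n⇒m⊓n≡m (≤-trans (n≤1+n _) (n≤1+n _)))

  capped-far : ∀ {x y : TV d h} (px : IsLeaf x) → 2 + depth x ≤ dist px y → capped px y ≡ 2 + depth x
  capped-far px = m≥n⇒m⊓n≡n

  K : ℕ
  K = depth b + (3 + depth a)

  potential : SV d h → ℕ
  potential (inS x) = capped pa x
  potential (inT y) = K ∸ capped pb y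

  potential-inT-b : potential (inT b) ≡ 3 + depth a
  potential-inT-b = trans (cong (K ∸_) (capped-self pb)) (m+n∸m≡n (depth b) (3 + depth a))

  potential-inT-far : ∀ {y} → 2 + depth b ≤ dist pb y → potential (inT y) ≡ suc (depth a)
  potential-inT-far y-far = begin
    K ∸ capped pb _                          ≡⟨ cong (K ∸_) (capped-far pb y-far) ⟩
    depth b + (3 + depth a) ∸ (2 + depth b)  ≡⟨ cong (K ∸_) (+-comm 2 (depth b)) ⟩
    depth b + (3 + depth a) ∸ (depth b + 2)  ≡⟨ [m+n]∸[m+o]≡n∸o (depth b) (3 + depth a) 2 ⟩
    suc (depth a)                            ∎
    where open ≡-Reasoning

  potential-Near : ∀ e → e ∉ faults → e ≡ e₀ ⊎ NearAlong potential e
  potential-Near (sE e) e∉ with tends e in eq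
  ... | x , y with dist-step pa e eq
  ...   | inj₁ e∈cut = ⊥-elim (e∉ (∈-++⁺ˡ (∈-map⁺ sE e∈cut)))
  ...   | inj₂ step  = inj₂ (Near-⊓ _ (Step⇒Near step))
  potential-Near (tE e) e∉ with tends e in eq
  ... | x , y with dist-step pb e eq
  ...   | inj₁ e∈cut = ⊥-elim (e∉ (∈-++⁺ʳ (map sE (cut pa)) (∈-map⁺ tE e∈cut)))
  ...   | inj₂ step  = inj₂ (Near-∸ K (Near-⊓ _ (Step⇒Near step)))
  potential-Near (bE x y px py) _ with other-leaf-far pa px | other-leaf-far pb py
  ... | inj₁ refl | inj₁ refl = inj₁ (cong₂ (bE a b) (IsLeaf-irrelevant px pa) (IsLeaf-irrelevant py pb))
  ... | inj₁ refl  | inj₂ y-far =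
    inj₂ (subst₂ Near (sym (capped-self pa)) (sym (potential-inT-far y-far)) (Near-suc _))
  ... | inj₂ x-far | inj₁ refl  =
    inj₂ (subst₂ Near (sym (capped-far pa x-far)) (sym potential-inT-b) (Near-suc _))
  ... | inj₂ x-far | inj₂ y-far =
    inj₂ (subst₂ Near (sym (capped-far pa x-far)) (sym (potential-inT-far y-far)) (Near-sym (Near-suc _)))

  potential-gap : ∀ {k} → k ≤ depth a + suc (depth b) + 1 → ¬ (potential t ≤ k + potential s)
  potential-gap {k} k≤ K≤ = <-irrefl refl (begin-strict
    depth a + suc (depth b) + 1  <⟨ ≤-reflexive (K≡ (depth a) (depth b)) ⟩
    K                            ≡⟨ cong (K ∸_) (sym (capped-root pb)) ⟩
    potential t                  ≤⟨ K≤ ⟩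
    k + potential s              ≡⟨ trans (cong (k +_) (capped-root pa)) (+-identityʳ k) ⟩
    k                            ≤⟨ k≤ ⟩
    depth a + suc (depth b) + 1  ∎)
    where
    open ≤-Reasoning
    K≡ : ∀ x y → suc (x + suc y + 1) ≡ y + (3 + x)
    K≡ = solve-∀

  edge-forced : (H : SE d h → Set) → FTSpanner d h (2 * h) 1 H → H e₀
  edge-forced H span with span faults length-faults _ detour
  ... | k , k≤ , w = [ id , ⊥-elim ∘ potential-gap k≤ ]′ (walk-potential-bound potential near w)
    where
    near : ∀ {e} → H e × e ∉ faults → H e₀ ⊎ NearAlong potential e
    near {e} (He , e∉) with potential-Near e e∉
    ... | inj₁ refl = inj₁ He
    ... | inj₂ φe≈  = inj₂ φe≈

lemma6 : (d h : ℕ) {{_ : NonZero d}} → 1 ≤ h →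
         (H : SE d h → Set) →
         (FTPreserver d h (2 * h) H ⊎ FTSpanner d h (2 * h) 1 H) →
         (a b : TV d h) (pa : IsLeaf a) (pb : IsLeaf b) → H (bE a b pa pb)
-- The argument does not need 1 ≤ h: for h = 0 the graph is the single edge (s, t).
lemma6 (suc n) h _ H spanner a b pa pb = edge-forced H 1-spanner
  where
  open Forcing n pa pb
  1-spanner : FTSpanner (suc n) h (2 * h) 1 H
  1-spanner = [ FTSpanner-mono z≤n , id ]′ spanner
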